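{- There are arbitrarily long square-free words $w\in\{0,1,2\}^*$ with $\eta(w)=|w|-5$; that is, for every $N$ there is a square-free $w\in\{0,1,2\}^*$ with $|w|\ge N$ and $\eta(w)=|w|-5$.
   Context: A word is square-free if it has no factor $vv$ with $v$ nonempty. A position of $w$ is an integer $p$ with $1\le p<|w|$; write $w=xy$ with $|x|=p$. A nonempty word $u$ is a repetition word of $w$ at $p$ if there are (possibly empty) words $x',y'$ with ($u=x'x$ or $x=x'u$) and ($u=yy'$ or $y=uy'$). $\mathrm{per}(w,p)$ is the minimal length of a repetition word at $p$. An integer $q$ with $1\le q\le |w|$ is a period of $w$ if $w$ is a prefix of $z^n$ for some $n$, where $z$ is the prefix of $w$ of length $q$; $\mathrm{per}(w)$ is the minimal period. A position $p$ is critical if $\mathrm{per}(w,p)=\mathrm{per}(w)$, and $\eta(w)$ denotes the number of critical points of $w$. -}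

module Defs where

open import Data.Nat using (ℕ; _≤_; _<_)
open import Data.Fin using (Fin)
open import Data.List using (List; []; _++_; length; take; drop; concat; replicate)
open import Data.List.Membership.Propositional using (_∈_)
open import Data.List.Relation.Unary.Unique.Propositional using (Unique)
open import Data.Product using (Σ; ∃; ∃-syntax; _×_)
open import Data.Sum using (_⊎_)
open import Relation.Binary.PropositionalEquality using (_≡_; _≢_)
open import Relation.Nullary using (¬_)

Word : Set
Word = List (Fin 3)

SquareFree : Word → Set
SquareFree w = ∀ (a v b : Word) → v ≢ [] → w ≢ a ++ (v ++ v) ++ b

Position : Word → ℕ → Set
Position w p = 1 ≤ p × p < length w

RepWord : Word → ℕ → Word → Set
RepWord w p u =
  u ≢ [] ×
  ((∃[ x' ] u ≡ x' ++ x) ⊎ (∃[ x' ] x ≡ x' ++ u)) ×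
  ((∃[ y' ] u ≡ y ++ y') ⊎ (∃[ y' ] y ≡ u ++ y'))
  where
  x = take p w
  y = drop p w

LocalPer : Word → ℕ → ℕ → Set
LocalPer w p q =
  (∃[ u ] (RepWord w p u × length u ≡ q)) ×
  (∀ u → RepWord w p u → q ≤ length u)

Period : Word → ℕ → Set
Period w q =
  1 ≤ q × q ≤ length w ×
  (∃[ n ] ∃[ s ] (w ++ s ≡ concat (replicate n (take q w))))

MinPer : Word → ℕ → Set
MinPer w q = Period w q × (∀ q' → Period w q' → q ≤ q')

Critical : Word → ℕ → Set
Critical w p = Position w p × ∃[ q ] (LocalPer w p q × MinPer w q)

Eta : Word → ℕ → Set
Eta w k = ∃[ ps ] (Unique ps × (∀ p → (p ∈ ps → Critical w p) × (Critical w p → p ∈ ps)) × length ps ≡ k)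

-- The witnesses are w = 0 · vtm[1 .. 2n + 5] · 2, where vtm(k) = 1 + t(k + 1) − t(k) is the ternary word
-- derived from the Thue–Morse word t. As t is overlap-free, vtm is square-free, and by its coding it never
-- contains 010 or 212. Choosing n with t[n .. n + 3] = 1001 (such n are unbounded, since n ↦ 4n + 6
-- preserves this) makes w begin with 010201 and end with 120212, so 010 and 212 occur in w only as its
-- prefix and suffix. Hence w is square-free and unbordered, so per(w) = |w|. At a position 3 ≤ p ≤ |w| − 3
-- a repetition word shorter than w would give a square, another occurrence of 010 or 212, or a border,
-- so p is critical, while positions 1, 2, |w| − 2, |w| − 1 carry the short repetition words 10, 0201, 1202
-- and 21. Thus η(w) = |w| − 5.

module Submission where

open import Defs
open import Data.Bool using (Bool; true; false; not; _xor_)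
open import Data.Bool.Properties using (not-involutive; not-injective; not-¬)
open import Data.Empty using (⊥; ⊥-elim)
open import Data.Fin using (Fin; zero; suc)
open import Data.List using (List; []; _∷_; _++_; length; take; drop; reverse; applyUpTo; concat; replicate)
open import Data.List.Properties
  using (∷-injective; ∷-injectiveˡ; ∷-injectiveʳ; ∷ʳ-injectiveʳ; ++-assoc; ++-cancelˡ; ++-conicalˡ; ++-conicalʳ;
         ++-identityʳ; ++-monoid; length-++; length-take; length-applyUpTo; take++drop≡id; take-all;
         reverse-++; reverse-involutive)
open import Data.List.Membership.Propositional using (_∈_)
open import Data.List.Membership.Propositional.Properties using (∈-applyUpTo⁺; ∈-applyUpTo⁻)
open import Data.List.Relation.Unary.Unique.Propositional using (Unique)
open import Data.List.Relation.Unary.Unique.Propositional.Properties using (applyUpTo⁺₁)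
open import Data.Nat
open import Data.Nat.Induction using (<-wellFounded)
open import Data.Nat.Properties
open import Algebra.Properties.CommutativeSemigroup +-commutativeSemigroup using (interchange)
open import Data.Nat.Tactic.RingSolver using (solve-∀)
open import Tactic.MonoidSolver using (solve)
open import Data.Product using (∃-syntax; _×_; _,_; proj₂)
open import Data.Sum using (_⊎_; inj₁; inj₂)
open import Function using (_∘′_)
open import Function.Bundles using (_⇔_; mk⇔; Equivalence)
open import Induction.WellFounded using (Acc; acc)
open import Relation.Binary.PropositionalEquality
open import Relation.Nullary using (¬_; yes; no)
open import Relation.Nullary.Decidable using (_×-dec_)

module _ {A : Set} where

  ++-split : ∀ (a b c d : List A) → a ++ b ≡ c ++ d → length a ≤ length c → ∃[ r ] (c ≡ a ++ r × b ≡ r ++ d)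
  ++-split []      b c       d e _         = c , refl , e
  ++-split (x ∷ a) b (y ∷ c) d e (s≤s a≤c)
    with refl , e′ ← ∷-injective e
    with r , c≡ , b≡ ← ++-split a b c d e′ a≤c = r , cong (x ∷_) c≡ , b≡

  take-length-++ : ∀ (xs ys : List A) k → take (length xs + k) (xs ++ ys) ≡ xs ++ take k ys
  take-length-++ []       ys k = refl
  take-length-++ (x ∷ xs) ys k = cong (x ∷_) (take-length-++ xs ys k)

  drop-length-++ : ∀ (xs ys : List A) k → drop (length xs + k) (xs ++ ys) ≡ drop k ys
  drop-length-++ []       ys k = refl
  drop-length-++ (x ∷ xs) ys k = drop-length-++ xs ys k

  drop-++-≤ : ∀ (xs ys : List A) p → p ≤ length xs → drop p (xs ++ ys) ≡ drop p xs ++ ys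
  drop-++-≤ xs       ys zero    _         = refl
  drop-++-≤ (x ∷ xs) ys (suc p) (s≤s p≤) = drop-++-≤ xs ys p p≤

  length-take-≤ : ∀ p (xs : List A) → p ≤ length xs → length (take p xs) ≡ p
  length-take-≤ p xs p≤ = trans (length-take p xs) (m≤n⇒m⊓n≡m p≤)

  1≤length : ∀ (v : List A) → v ≢ [] → 1 ≤ length v
  1≤length []      v≢[] = ⊥-elim (v≢[] refl)
  1≤length (_ ∷ _) _    = s≤s z≤n

  window : (ℕ → A) → ℕ → ℕ → List A
  window f s zero    = []
  window f s (suc l) = f s ∷ window f (suc s) l

  window-++ : ∀ f s a b → window f s (a + b) ≡ window f s a ++ window f (s + a) b
  window-++ f s zero    b = cong (λ s′ → window f s′ b) (sym (+-identityʳ s))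
  window-++ f s (suc a) b =
    cong (f s ∷_) (trans (window-++ f (suc s) a b)
                         (cong (λ s′ → window f (suc s) a ++ window f s′ b) (sym (+-suc s a))))

  window-prefix : ∀ f s L (v b : List A) → window f s L ≡ v ++ b → v ≡ window f s (length v)
  window-prefix f s L       []      b _ = refl
  window-prefix f s (suc L) (x ∷ v) b e =
    cong₂ _∷_ (sym (∷-injectiveˡ e)) (window-prefix f (suc s) L v b (∷-injectiveʳ e))

  window-factor : ∀ f s L (a v b : List A) → window f s L ≡ a ++ v ++ b →
                  v ≡ window f (s + length a) (length v)
  window-factor f s L       []      v b e =
    trans (window-prefix f s L v b e) (cong (λ s′ → window f s′ (length v)) (sym (+-identityʳ s)))
  window-factor f s (suc L) (x ∷ a) v b e =
    trans (window-factor f (suc s) L a v b (∷-injectiveʳ e))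
          (cong (λ s′ → window f s′ (length v)) (sym (+-suc s (length a))))

  window-pointwise : ∀ f a b l → window f a l ≡ window f b l → ∀ j → j < l → f (j + a) ≡ f (j + b)
  window-pointwise f a b (suc l) e zero    _         = ∷-injectiveˡ e
  window-pointwise f a b (suc l) e (suc j) (s≤s j<l) =
    subst₂ (λ x y → f x ≡ f y) (+-suc j a) (+-suc j b)
           (window-pointwise f (suc a) (suc b) l (∷-injectiveʳ e) j j<l)

  length-window : ∀ (f : ℕ → A) s l → length (window f s l) ≡ l
  length-window f s zero    = refl
  length-window f s (suc l) = cong suc (length-window f (suc s) l)

  Avoids : List A → List A → Set
  Avoids u w = ∀ a b → w ≢ a ++ u ++ b

  OnlyPrefix : List A → List A → Set
  OnlyPrefix u w = ∀ a b → w ≡ a ++ u ++ b → a ≡ []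

  OnlySuffix : List A → List A → Set
  OnlySuffix u w = ∀ a b → w ≡ a ++ u ++ b → b ≡ []

  ∷ʳ-≡-++ : ∀ (X : List A) d P b → X ++ d ∷ [] ≡ P ++ b → b ≡ [] ⊎ ∃[ b′ ] X ≡ P ++ b′
  ∷ʳ-≡-++ X       d []      b e = inj₂ (X , refl)
  ∷ʳ-≡-++ []      d (p ∷ P) b e = inj₁ (++-conicalʳ P b (sym (∷-injectiveʳ e)))
  ∷ʳ-≡-++ (x ∷ X) d (p ∷ P) b e with ∷ʳ-≡-++ X d P b (∷-injectiveʳ e)
  ... | inj₁ b≡[]      = inj₁ b≡[]
  ... | inj₂ (b′ , X≡) = inj₂ (b′ , cong₂ _∷_ (∷-injectiveˡ e) X≡)

  factor-∷-∷ʳ : ∀ c (V : List A) d a f b → c ∷ V ++ d ∷ [] ≡ a ++ f ++ b →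
                a ≡ [] ⊎ b ≡ [] ⊎ ∃[ a′ ] ∃[ b′ ] V ≡ a′ ++ f ++ b′
  factor-∷-∷ʳ c V d []       f b e = inj₁ refl
  factor-∷-∷ʳ c V d (x ∷ a′) f b e
    with ∷ʳ-≡-++ V d (a′ ++ f) b (trans (∷-injectiveʳ e) (sym (++-assoc a′ f b)))
  ... | inj₁ b≡[]      = inj₂ (inj₁ b≡[])
  ... | inj₂ (b′ , V≡) = inj₂ (inj₂ (a′ , b′ , trans V≡ (++-assoc a′ f b′)))

  -- The only squares that could start a word c d c e … are cc, (cd)², or one beginning with c d c,
  -- whose second half contains a further occurrence of c d c.
  no-square-prefix : ∀ {c d e X} (w : List A) → w ≡ c ∷ d ∷ c ∷ e ∷ X → c ≢ d → d ≢ e →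
                   OnlyPrefix (c ∷ d ∷ c ∷ []) w → ∀ v b → v ≢ [] → w ≢ (v ++ v) ++ b
  no-square-prefix w w≡   c≢d d≢e only []           b v≢[] _    = v≢[] refl
  no-square-prefix w refl c≢d d≢e only (x ∷ [])     b _    refl = c≢d refl
  no-square-prefix w refl c≢d d≢e only (x ∷ y ∷ []) b _    refl = d≢e refl
  no-square-prefix {c} {d} w w≡ c≢d d≢e only (x ∷ y ∷ z ∷ v) b _ e
    with refl , eq₁ ← ∷-injective (trans (sym w≡) e)
    with refl , eq₂ ← ∷-injective eq₁
    with refl , _   ← ∷-injective eq₂
    with () ← only (c ∷ d ∷ c ∷ v) (v ++ b) (trans e (cong (λ u → c ∷ d ∷ c ∷ u) (++-assoc v _ b)))

  onlySuffix-reverse : ∀ {u w} → OnlySuffix u w → OnlyPrefix (reverse u) (reverse w)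
  onlySuffix-reverse {u} {w} only a b e = begin
    a                          ≡⟨ reverse-involutive a ⟨
    reverse (reverse a)        ≡⟨ cong reverse (only (reverse b) (reverse a) w≡) ⟩
    []                         ∎
    where
    open ≡-Reasoning
    w≡ : w ≡ reverse b ++ u ++ reverse a
    w≡ = begin
      w                                          ≡⟨ reverse-involutive w ⟨
      reverse (reverse w)                        ≡⟨ cong reverse e ⟩
      reverse (a ++ reverse u ++ b)              ≡⟨ reverse-++ a _ ⟩
      reverse (reverse u ++ b) ++ reverse a      ≡⟨ cong (_++ reverse a) (reverse-++ (reverse u) b) ⟩
      (reverse b ++ reverse (reverse u)) ++ reverse a
        ≡⟨ cong (λ u′ → (reverse b ++ u′) ++ reverse a) (reverse-involutive u) ⟩
      (reverse b ++ u) ++ reverse a              ≡⟨ ++-assoc (reverse b) u (reverse a) ⟩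
      reverse b ++ u ++ reverse a                ∎

  no-square-suffix : ∀ {c d e Y} (w : List A) → w ≡ Y ++ e ∷ c ∷ d ∷ c ∷ [] → c ≢ d → d ≢ e →
                   OnlySuffix (c ∷ d ∷ c ∷ []) w → ∀ a v → v ≢ [] → w ≢ a ++ (v ++ v) ++ []
  no-square-suffix {Y = Y} w w≡ c≢d d≢e only a v v≢[] e =
    no-square-prefix (reverse w) (trans (cong reverse w≡) (reverse-++ Y _)) c≢d d≢e (onlySuffix-reverse only)
                     (reverse v) (reverse a) reverse-v≢[] reversed
    where
    open ≡-Reasoning
    reverse-v≢[] : reverse v ≢ []
    reverse-v≢[] r≡[] = v≢[] (trans (sym (reverse-involutive v)) (cong reverse r≡[]))
    reversed : reverse w ≡ (reverse v ++ reverse v) ++ reverse a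
    reversed = begin
      reverse w                             ≡⟨ cong reverse e ⟩
      reverse (a ++ (v ++ v) ++ [])         ≡⟨ reverse-++ a _ ⟩
      reverse ((v ++ v) ++ []) ++ reverse a ≡⟨ cong (λ u → reverse u ++ reverse a) (++-identityʳ (v ++ v)) ⟩
      reverse (v ++ v) ++ reverse a         ≡⟨ cong (_++ reverse a) (reverse-++ v v) ⟩
      (reverse v ++ reverse v) ++ reverse a ∎

-- The Thue–Morse word

isOdd : ℕ → Bool
isOdd zero    = false
isOdd (suc n) = not (isOdd n)

isOdd-double : ∀ n → isOdd (n + n) ≡ false
isOdd-double zero = refl
isOdd-double (suc n) rewrite +-suc n n | isOdd-double n = refl

-- t n is the parity of the binary digit sum of n; fuel f ≥ n suffices since each step halves n.
thueMorseFuel : ℕ → ℕ → Bool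
thueMorseFuel zero    n = false
thueMorseFuel (suc f) n = isOdd n xor thueMorseFuel f ⌊ n /2⌋

thueMorse : ℕ → Bool
thueMorse n = thueMorseFuel n n

thueMorseFuel-0 : ∀ f → thueMorseFuel f 0 ≡ false
thueMorseFuel-0 zero    = refl
thueMorseFuel-0 (suc f) = thueMorseFuel-0 f

thueMorseFuel-irrelevant : ∀ {f g n} → n ≤ f → n ≤ g → thueMorseFuel f n ≡ thueMorseFuel g n
thueMorseFuel-irrelevant {zero}  {g}     z≤n _ = sym (thueMorseFuel-0 g)
thueMorseFuel-irrelevant {suc f} {zero}  _ z≤n = thueMorseFuel-0 (suc f)
thueMorseFuel-irrelevant {suc f} {suc g} {zero} _ _ =
  trans (thueMorseFuel-0 f) (sym (thueMorseFuel-0 g))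
thueMorseFuel-irrelevant {suc f} {suc g} {suc n} (s≤s n≤f) (s≤s n≤g) =
  cong (isOdd (suc n) xor_) (thueMorseFuel-irrelevant (≤-trans half≤n n≤f) (≤-trans half≤n n≤g))
  where
  half≤n : ⌊ suc n /2⌋ ≤ n
  half≤n = ≤-pred (⌊n/2⌋<n n)

thueMorse-unfold : ∀ n → thueMorse n ≡ isOdd n xor thueMorse ⌊ n /2⌋
thueMorse-unfold zero    = refl
thueMorse-unfold (suc n) =
  cong (isOdd (suc n) xor_) (thueMorseFuel-irrelevant (≤-pred (⌊n/2⌋<n n)) ≤-refl)

thueMorse-double : ∀ n → thueMorse (n + n) ≡ thueMorse n
thueMorse-double n
  rewrite thueMorse-unfold (n + n) | isOdd-double n = cong thueMorse (sym (n≡⌊n+n/2⌋ n))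

thueMorse-double+1 : ∀ n → thueMorse (suc (n + n)) ≡ not (thueMorse n)
thueMorse-double+1 n
  rewrite thueMorse-unfold (suc (n + n)) | isOdd-double n = cong (not ∘′ thueMorse) (sym (n≡⌈n+n/2⌉ n))

thueMorse-2d+2n : ∀ d n → thueMorse ((d + d) + (n + n)) ≡ thueMorse (d + n)
thueMorse-2d+2n d n = trans (cong thueMorse (sym (interchange d n d n))) (thueMorse-double (d + n))

thueMorse-2d+2n+1 : ∀ d n → thueMorse (suc ((d + d) + (n + n))) ≡ not (thueMorse (d + n))
thueMorse-2d+2n+1 d n =
  trans (cong (thueMorse ∘′ suc) (sym (interchange d n d n))) (thueMorse-double+1 (d + n))

-- The factor t[i .. i + 2l] is an overlap of period l.
HasOverlap : ℕ → ℕ → Set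
HasOverlap i l = ∀ x → i ≤ x → x ≤ i + l → thueMorse x ≡ thueMorse (x + l)

overlap-fromOffsets : ∀ i l → (∀ j → j ≤ l → thueMorse (j + i) ≡ thueMorse (j + (i + l))) →
                      HasOverlap i l
overlap-fromOffsets i l periodic x i≤x x≤i+l = begin
  thueMorse x                      ≡⟨ cong thueMorse (m∸n+n≡m i≤x) ⟨
  thueMorse (x ∸ i + i)            ≡⟨ periodic (x ∸ i) (m≤n+o⇒m∸n≤o x i x≤i+l) ⟩
  thueMorse (x ∸ i + (i + l))      ≡⟨ cong thueMorse (+-assoc (x ∸ i) i l) ⟨
  thueMorse (x ∸ i + i + l)        ≡⟨ cong (λ y → thueMorse (y + l)) (m∸n+n≡m i≤x) ⟩
  thueMorse (x + l)                ∎
  where open ≡-Reasoning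

overlap-halve-even : ∀ k m → HasOverlap (k + k) (m + m) → HasOverlap k m
overlap-halve-even k m periodic x k≤x x≤k+m = begin
  thueMorse x                       ≡⟨ thueMorse-double x ⟨
  thueMorse (x + x)                 ≡⟨ periodic (x + x) (+-mono-≤ k≤x k≤x) x+x≤ ⟩
  thueMorse (x + x + (m + m))       ≡⟨ cong thueMorse (interchange x m x m) ⟨
  thueMorse ((x + m) + (x + m))     ≡⟨ thueMorse-double (x + m) ⟩
  thueMorse (x + m)                 ∎
  where
  open ≡-Reasoning
  x+x≤ : x + x ≤ k + k + (m + m)
  x+x≤ = ≤-trans (+-mono-≤ x≤k+m x≤k+m) (≤-reflexive (interchange k m k m))

overlap-halve-odd : ∀ k m → HasOverlap (suc (k + k)) (m + m) → HasOverlap k m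
overlap-halve-odd k m periodic x k≤x x≤k+m = not-injective (begin
  not (thueMorse x)                       ≡⟨ thueMorse-double+1 x ⟨
  thueMorse (suc (x + x))                 ≡⟨ periodic (suc (x + x)) (s≤s (+-mono-≤ k≤x k≤x)) x+x≤ ⟩
  thueMorse (suc (x + x + (m + m)))       ≡⟨ cong (thueMorse ∘′ suc) (interchange x m x m) ⟨
  thueMorse (suc ((x + m) + (x + m)))     ≡⟨ thueMorse-double+1 (x + m) ⟩
  not (thueMorse (x + m))                 ∎)
  where
  open ≡-Reasoning
  x+x≤ : suc (x + x) ≤ suc (k + k + (m + m))
  x+x≤ = s≤s (≤-trans (+-mono-≤ x≤k+m x≤k+m) (≤-reflexive (interchange k m k m)))

-- An overlap of odd period 2m + 1 starting at i contains a position 2k ∈ {i, i + 1}.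
-- The overlap forces t to be constant on [k, k + m], which clashes with t(2k) = t(2k + 2m + 1).
no-overlap-oddPeriod : ∀ i k m → i ≤ k + k → k + k ≤ suc i → ¬ HasOverlap i (suc (m + m))
no-overlap-oddPeriod i k m i≤2k 2k≤1+i periodic = not-¬ refl t[k]≡not-t[k]
  where
  l = suc (m + m)
  1+i≤i+l : suc i ≤ i + l
  1+i≤i+l = ≤-trans (s≤s (m≤m+n i (m + m))) (≤-reflexive (sym (+-suc i (m + m))))
  step : ∀ r → r < m → thueMorse (suc (k + r)) ≡ thueMorse (k + r)
  step r r<m = t[x+1]≡t[x]
    where
    x = k + r
    y = x + suc m
    2a+2+l≡2[a+b+1]+1 : ∀ a b → suc (suc (a + a)) + suc (b + b) ≡ suc ((a + suc b) + (a + suc b))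
    2a+2+l≡2[a+b+1]+1 = solve-∀
    2[a+b+1]≡2a+1+l : ∀ a b → (a + suc b) + (a + suc b) ≡ suc (a + a) + suc (b + b)
    2[a+b+1]≡2a+1+l = solve-∀
    i≤2x : i ≤ x + x
    i≤2x = ≤-trans i≤2k (+-mono-≤ (m≤m+n k r) (m≤m+n k r))
    2x+2≤i+l : suc (suc (x + x)) ≤ i + l
    2x+2≤i+l = begin
      suc (suc (x + x))        ≡⟨ cong suc (+-suc x x) ⟨
      suc x + suc x            ≤⟨ +-mono-≤ x+1≤k+m x+1≤k+m ⟩
      (k + m) + (k + m)        ≡⟨ interchange k m k m ⟩
      (k + k) + (m + m)        ≤⟨ +-monoˡ-≤ (m + m) 2k≤1+i ⟩
      suc i + (m + m)          ≡⟨ +-suc i (m + m) ⟨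
      i + l                    ∎
      where
      open ≤-Reasoning
      x+1≤k+m : suc x ≤ k + m
      x+1≤k+m = ≤-trans (≤-reflexive (sym (+-suc k r))) (+-monoʳ-≤ k r<m)
    2x+1≤i+l : suc (x + x) ≤ i + l
    2x+1≤i+l = ≤-trans (n≤1+n _) 2x+2≤i+l
    t[x+1]≡t[x] : thueMorse (suc x) ≡ thueMorse x
    t[x+1]≡t[x] = begin
      thueMorse (suc x)                      ≡⟨ thueMorse-double (suc x) ⟨
      thueMorse (suc x + suc x)              ≡⟨ cong (thueMorse ∘′ suc) (+-suc x x) ⟩
      thueMorse (suc (suc (x + x)))          ≡⟨ periodic _ (≤-trans i≤2x (≤-trans (n≤1+n _) (n≤1+n _))) 2x+2≤i+l ⟩
      thueMorse (suc (suc (x + x)) + l)      ≡⟨ cong thueMorse (2a+2+l≡2[a+b+1]+1 x m) ⟩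
      thueMorse (suc (y + y))                ≡⟨ thueMorse-double+1 y ⟩
      not (thueMorse y)                      ≡⟨ cong not (thueMorse-double y) ⟨
      not (thueMorse (y + y))                ≡⟨ cong (not ∘′ thueMorse) (2[a+b+1]≡2a+1+l x m) ⟩
      not (thueMorse (suc (x + x) + l))      ≡⟨ cong not (periodic _ (≤-trans i≤2x (n≤1+n _)) 2x+1≤i+l) ⟨
      not (thueMorse (suc (x + x)))          ≡⟨ cong not (thueMorse-double+1 x) ⟩
      not (not (thueMorse x))                ≡⟨ not-involutive _ ⟩
      thueMorse x                            ∎
      where open ≡-Reasoning
  constant : ∀ r → r ≤ m → thueMorse (k + r) ≡ thueMorse k
  constant zero    _   = cong thueMorse (+-identityʳ k)
  constant (suc r) r<m =
    trans (cong thueMorse (+-suc k r)) (trans (step r r<m) (constant r (<⇒≤ r<m)))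
  2a+l≡2[a+b]+1 : ∀ a b → a + a + suc (b + b) ≡ suc ((a + b) + (a + b))
  2a+l≡2[a+b]+1 = solve-∀
  t[k]≡not-t[k] : thueMorse k ≡ not (thueMorse k)
  t[k]≡not-t[k] = begin
    thueMorse k                           ≡⟨ thueMorse-double k ⟨
    thueMorse (k + k)                     ≡⟨ periodic (k + k) i≤2k (≤-trans 2k≤1+i 1+i≤i+l) ⟩
    thueMorse (k + k + l)                 ≡⟨ cong thueMorse (2a+l≡2[a+b]+1 k m) ⟩
    thueMorse (suc ((k + m) + (k + m)))   ≡⟨ thueMorse-double+1 (k + m) ⟩
    not (thueMorse (k + m))               ≡⟨ cong not (constant m ≤-refl) ⟩
    not (thueMorse k)                     ∎
    where open ≡-Reasoning

data Halves : ℕ → Set where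
  even : ∀ k → Halves (k + k)
  odd  : ∀ k → Halves (suc (k + k))

halves : ∀ n → Halves n
halves zero = even zero
halves (suc n) with halves n
... | even k = odd k
... | odd k  = subst Halves (cong suc (+-suc k k)) (even (suc k))

thueMorse-overlapFree : ∀ i l → 1 ≤ l → ¬ HasOverlap i l
thueMorse-overlapFree i l = go i (<-wellFounded l)
  where
  half-positive : ∀ {m} → 1 ≤ m + m → 1 ≤ m
  half-positive {suc m} _ = s≤s z≤n
  go : ∀ i {l} → Acc _<_ l → 1 ≤ l → ¬ HasOverlap i l
  go i {l} (acc smaller) 1≤l with halves l | halves i
  ... | even m | even k =
    go k (smaller (m<m+n m (half-positive 1≤l))) (half-positive 1≤l) ∘′ overlap-halve-even k m
  ... | even m | odd k  =
    go k (smaller (m<m+n m (half-positive 1≤l))) (half-positive 1≤l) ∘′ overlap-halve-odd k m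
  ... | odd m  | even k = no-overlap-oddPeriod (k + k) k m ≤-refl (n≤1+n _)
  ... | odd m  | odd k  =
    no-overlap-oddPeriod (suc (k + k)) (suc k) m (≤-trans (n≤1+n _) (≤-reflexive (sym 2k+2≡)))
                         (≤-reflexive 2k+2≡)
    where
    2k+2≡ : suc k + suc k ≡ suc (suc (k + k))
    2k+2≡ = cong suc (+-suc k k)

Block1001At : ℕ → Set
Block1001At n =
  thueMorse n ≡ true × thueMorse (1 + n) ≡ false × thueMorse (2 + n) ≡ false × thueMorse (3 + n) ≡ true

-- t[4n + 6 .. 4n + 9] is the middle of μ²(t(n + 1) t(n + 2)) = μ²(00) = 0110 0110, where μ : 0 ↦ 01, 1 ↦ 10.
block1001-step : ∀ n → Block1001At n → Block1001At (6 + ((n + n) + (n + n)))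
block1001-step n (_ , t₁ , t₂ , _) = t₀′ , t₁′ , t₂′ , t₃′
  where
  open ≡-Reasoning
  t₀′ : thueMorse (6 + ((n + n) + (n + n))) ≡ true
  t₀′ = begin
    thueMorse (6 + ((n + n) + (n + n)))   ≡⟨ thueMorse-2d+2n 3 (n + n) ⟩
    thueMorse (3 + (n + n))               ≡⟨ thueMorse-2d+2n+1 1 n ⟩
    not (thueMorse (1 + n))               ≡⟨ cong not t₁ ⟩
    true                                  ∎
  t₁′ : thueMorse (7 + ((n + n) + (n + n))) ≡ false
  t₁′ = begin
    thueMorse (7 + ((n + n) + (n + n)))   ≡⟨ thueMorse-2d+2n+1 3 (n + n) ⟩
    not (thueMorse (3 + (n + n)))         ≡⟨ cong not (thueMorse-2d+2n+1 1 n) ⟩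
    not (not (thueMorse (1 + n)))         ≡⟨ not-involutive _ ⟩
    thueMorse (1 + n)                     ≡⟨ t₁ ⟩
    false                                 ∎
  t₂′ : thueMorse (8 + ((n + n) + (n + n))) ≡ false
  t₂′ = begin
    thueMorse (8 + ((n + n) + (n + n)))   ≡⟨ thueMorse-2d+2n 4 (n + n) ⟩
    thueMorse (4 + (n + n))               ≡⟨ thueMorse-2d+2n 2 n ⟩
    thueMorse (2 + n)                     ≡⟨ t₂ ⟩
    false                                 ∎
  t₃′ : thueMorse (9 + ((n + n) + (n + n))) ≡ true
  t₃′ = begin
    thueMorse (9 + ((n + n) + (n + n)))   ≡⟨ thueMorse-2d+2n+1 4 (n + n) ⟩
    not (thueMorse (4 + (n + n)))         ≡⟨ cong not (thueMorse-2d+2n 2 n) ⟩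
    not (thueMorse (2 + n))               ≡⟨ cong not t₂ ⟩
    true                                  ∎

block1001-unbounded : ∀ N → ∃[ n ] (N ≤ n × Block1001At n)
block1001-unbounded zero    = 4 , z≤n , refl , refl , refl , refl
block1001-unbounded (suc N) with n , N≤n , block ← block1001-unbounded N =
  6 + ((n + n) + (n + n)) ,
  s≤s (≤-trans N≤n (≤-trans (m≤m+n n n) (≤-trans (m≤m+n (n + n) (n + n)) (m≤n+m _ 5)))) ,
  block1001-step n block

-- The ternary Thue–Morse word

pattern c0 = zero
pattern c1 = suc zero
pattern c2 = suc (suc zero)

-- code a b = 1 + b − a, so vtm n = 1 + t(n + 1) − t(n).
code : Bool → Bool → Fin 3
code false false = c1
code false true  = c2
code true  false = c0
code true  true  = c1

vtm : ℕ → Fin 3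
vtm n = code (thueMorse n) (thueMorse (suc n))

code-xor : ∀ a b c d → code a b ≡ code c d → a xor c ≡ b xor d
code-xor false false false false _ = refl
code-xor false false true  true  _ = refl
code-xor false true  false true  _ = refl
code-xor true  false true  false _ = refl
code-xor true  true  false false _ = refl
code-xor true  true  true  true  _ = refl
code-xor false false false true  ()
code-xor false false true  false ()
code-xor false true  false false ()
code-xor false true  true  false ()
code-xor false true  true  true  ()
code-xor true  false false false ()
code-xor true  false false true  ()
code-xor true  false true  true  ()
code-xor true  true  false true  ()
code-xor true  true  true  false ()

code-complement : ∀ a b → code a b ≡ code (not a) (not b) → a ≡ b
code-complement false false _ = refl
code-complement true  true  _ = refl

xor≡false⇒≡ : ∀ a b → a xor b ≡ false → a ≡ b
xor≡false⇒≡ false false _ = refl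
xor≡false⇒≡ true  true  _ = refl

xor≡true⇒≡not : ∀ a b → a xor b ≡ true → b ≡ not a
xor≡true⇒≡not false true  _ = refl
xor≡true⇒≡not true  false _ = refl

-- The differences t(j + i) xor t(j + i + l) are constant along a square of vtm: if they vanish,
-- t has an overlap; otherwise the second half of t is the complement of the first, which forces
-- t to be constant on [i, i + l].
vtm-squareFree : ∀ i l → 1 ≤ l → ¬ (∀ j → j < l → vtm (j + i) ≡ vtm (j + (i + l)))
vtm-squareFree i l 1≤l square = by-difference (t₁ 0 xor t₂ 0) refl
  where
  t₁ t₂ : ℕ → Bool
  t₁ j = thueMorse (j + i)
  t₂ j = thueMorse (j + (i + l))
  difference-constant : ∀ j → j ≤ l → t₁ j xor t₂ j ≡ t₁ 0 xor t₂ 0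
  difference-constant zero    _   = refl
  difference-constant (suc j) j<l =
    trans (sym (code-xor _ _ _ _ (square j j<l))) (difference-constant j (<⇒≤ j<l))
  by-difference : ∀ d → t₁ 0 xor t₂ 0 ≡ d → ⊥
  by-difference false d₀ = thueMorse-overlapFree i l 1≤l (overlap-fromOffsets i l agree)
    where
    agree : ∀ j → j ≤ l → t₁ j ≡ t₂ j
    agree j j≤l = xor≡false⇒≡ _ _ (trans (difference-constant j j≤l) d₀)
  by-difference true  d₀ = not-¬ (trans (cong thueMorse (+-comm i l)) (constant l ≤-refl)) (complement 0 z≤n)
    where
    complement : ∀ j → j ≤ l → t₂ j ≡ not (t₁ j)
    complement j j≤l = xor≡true⇒≡not _ _ (trans (difference-constant j j≤l) d₀)
    constant : ∀ j → j ≤ l → t₁ j ≡ t₁ 0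
    constant zero    _   = refl
    constant (suc j) j<l = trans (sym (code-complement _ _ flipped)) (constant j (<⇒≤ j<l))
      where
      flipped : code (t₁ j) (t₁ (suc j)) ≡ code (not (t₁ j)) (not (t₁ (suc j)))
      flipped = trans (square j j<l) (cong₂ code (complement j (<⇒≤ j<l)) (complement (suc j) j<l))

window-vtm-squareFree : ∀ s L → SquareFree (window vtm s L)
window-vtm-squareFree s L a v b v≢[] e =
  vtm-squareFree i (length v) (1≤length v v≢[])
                 (window-pointwise vtm i (i + length v) (length v) (trans (sym first) second))
  where
  i = s + length a
  first : v ≡ window vtm i (length v)
  first = window-factor vtm s L a v (v ++ b) (trans e (solve (++-monoid (Fin 3))))
  second : v ≡ window vtm (i + length v) (length v)
  second = trans (window-factor vtm s L (a ++ v) v b (trans e (solve (++-monoid (Fin 3)))))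
                 (cong (λ s′ → window vtm s′ (length v))
                       (trans (cong (s +_) (length-++ a)) (sym (+-assoc s (length a) (length v)))))

code-no010 : ∀ a b c d → code a b ∷ code b c ∷ code c d ∷ [] ≢ c0 ∷ c1 ∷ c0 ∷ []
code-no010 false false _     _     ()
code-no010 false true  _     _     ()
code-no010 true  true  _     _     ()
code-no010 true  false true  _     ()
code-no010 true  false false false ()
code-no010 true  false false true  ()

code-no212 : ∀ a b c d → code a b ∷ code b c ∷ code c d ∷ [] ≢ c2 ∷ c1 ∷ c2 ∷ []
code-no212 false false _     _     ()
code-no212 true  false _     _     ()
code-no212 true  true  _     _     ()
code-no212 false true  false _     ()
code-no212 false true  true  false ()
code-no212 false true  true  true  ()

window-vtm-no010 : ∀ s L → Avoids (c0 ∷ c1 ∷ c0 ∷ []) (window vtm s L)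
window-vtm-no010 s L a b e = code-no010 _ _ _ _ (sym (window-factor vtm s L a _ b e))

window-vtm-no212 : ∀ s L → Avoids (c2 ∷ c1 ∷ c2 ∷ []) (window vtm s L)
window-vtm-no212 s L a b e = code-no212 _ _ _ _ (sym (window-factor vtm s L a _ b e))

vtm-tail : ∀ n → Block1001At n → window vtm (suc (n + n)) 5 ≡ c1 ∷ c2 ∷ c0 ∷ c2 ∷ c1 ∷ []
vtm-tail n (t₀ , t₁ , t₂ , t₃)
  rewrite thueMorse-2d+2n+1 0 n | thueMorse-2d+2n 1 n | thueMorse-2d+2n+1 1 n
        | thueMorse-2d+2n 2 n | thueMorse-2d+2n+1 2 n | thueMorse-2d+2n 3 n
        | t₀ | t₁ | t₂ | t₃ = refl

framed : Word → Word
framed V = c0 ∷ V ++ c2 ∷ []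

framed-only010 : ∀ V → Avoids (c0 ∷ c1 ∷ c0 ∷ []) V → OnlyPrefix (c0 ∷ c1 ∷ c0 ∷ []) (framed V)
framed-only010 V avoids a b e with factor-∷-∷ʳ c0 V c2 a _ b e
... | inj₁ a≡[]                  = a≡[]
... | inj₂ (inj₁ refl)
  with () ← ∷ʳ-injectiveʳ (c0 ∷ V) (a ++ c0 ∷ c1 ∷ []) (trans e (sym (++-assoc a _ _)))
... | inj₂ (inj₂ (a′ , b′ , V≡)) = ⊥-elim (avoids a′ b′ V≡)

framed-only212 : ∀ V → Avoids (c2 ∷ c1 ∷ c2 ∷ []) V → OnlySuffix (c2 ∷ c1 ∷ c2 ∷ []) (framed V)
framed-only212 V avoids a b e with factor-∷-∷ʳ c0 V c2 a _ b e
... | inj₁ refl                  with () ← ∷-injectiveˡ e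
... | inj₂ (inj₁ b≡[])           = b≡[]
... | inj₂ (inj₂ (a′ , b′ , V≡)) = ⊥-elim (avoids a′ b′ V≡)

framed-squareFree : ∀ V {X Y} → SquareFree V →
                    Avoids (c0 ∷ c1 ∷ c0 ∷ []) V → Avoids (c2 ∷ c1 ∷ c2 ∷ []) V →
                    framed V ≡ c0 ∷ c1 ∷ c0 ∷ c2 ∷ X → framed V ≡ Y ++ c0 ∷ c2 ∷ c1 ∷ c2 ∷ [] →
                    SquareFree (framed V)
framed-squareFree V sf avoids010 avoids212 pre suf a v b v≢[] e with factor-∷-∷ʳ c0 V c2 a _ b e
... | inj₁ refl =
  no-square-prefix (framed V) pre (λ ()) (λ ()) (framed-only010 V avoids010) v b v≢[] e
... | inj₂ (inj₁ refl) =
  no-square-suffix (framed V) suf (λ ()) (λ ()) (framed-only212 V avoids212) a v v≢[] e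
... | inj₂ (inj₂ (a′ , b′ , V≡)) = sf a′ v b′ v≢[] V≡

-- Periods and critical points

-- Only borders of length at most |w|/2 are excluded; in a square-free word there are no others.
Unbordered : Word → Set
Unbordered w = ∀ r M → r ≢ [] → w ≢ r ++ M ++ r

period-length : ∀ w → w ≢ [] → Period w (length w)
period-length w w≢[] =
  1≤length w w≢[] , ≤-refl , 1 , [] , cong (_++ []) (sym (take-all (length w) w ≤-refl))

-- A shorter period q makes w a prefix of z z z … with z = take q w: either w begins with the square z z,
-- or w is shorter than 2q and w = z w′ with w′ a prefix of z, a border.
minPer-length : ∀ w → w ≢ [] → SquareFree w → Unbordered w → MinPer w (length w)
minPer-length w w≢[] squareFree unbordered = period-length w w≢[] , minimal
  where
  minimal : ∀ q → Period w q → length w ≤ q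
  minimal q (1≤q , q≤n , m , s , e) with length w ≤? q
  ... | yes n≤q = n≤q
  ... | no  n≰q = ⊥-elim (not-a-prefix m e)
    where
    z  = take q w
    w′ = drop q w
    w≡zw′ : w ≡ z ++ w′
    w≡zw′ = sym (take++drop≡id q w)
    z≢[] : z ≢ []
    z≢[] z≡[] = <-irrefl (sym (trans (sym (length-take-≤ q w q≤n)) (cong length z≡[]))) 1≤q
    w′≢[] : w′ ≢ []
    w′≢[] w′≡[] = n≰q (≤-reflexive (begin
      length w            ≡⟨ cong length (trans w≡zw′ (cong (z ++_) w′≡[])) ⟩
      length (z ++ [])    ≡⟨ cong length (++-identityʳ z) ⟩
      length z            ≡⟨ length-take-≤ q w q≤n ⟩
      q                   ∎))
      where open ≡-Reasoning
    not-a-prefix′ : ∀ m → w′ ++ s ≢ concat (replicate m z)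
    not-a-prefix′ zero    e′ = w′≢[] (++-conicalˡ w′ s e′)
    not-a-prefix′ (suc m) e′ with ≤-total (length z) (length w′)
    ... | inj₁ z≤w′ with r , w′≡ , _ ← ++-split z _ w′ s (sym e′) z≤w′ =
      squareFree [] z r z≢[] (trans w≡zw′ (trans (cong (z ++_) w′≡) (sym (++-assoc z z r))))
    ... | inj₂ w′≤z with r , z≡ , _ ← ++-split w′ s z _ e′ w′≤z =
      unbordered w′ r w′≢[] (trans w≡zw′ (trans (cong (_++ w′) z≡) (++-assoc w′ r w′)))
    not-a-prefix : ∀ m → w ++ s ≢ concat (replicate m z)
    not-a-prefix zero    e′ = w≢[] (++-conicalˡ w s e′)
    not-a-prefix (suc m) e′ =
      not-a-prefix′ m (++-cancelˡ z _ _ (trans (sym (++-assoc z w′ s)) (trans (cong (_++ s) (sym w≡zw′)) e′)))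

rotation-repWord : ∀ w p → w ≢ [] → RepWord w p (drop p w ++ take p w)
rotation-repWord w p w≢[] = rotation≢[] , inj₁ (drop p w , refl) , inj₁ (take p w , refl)
  where
  rotation≢[] : drop p w ++ take p w ≢ []
  rotation≢[] e = w≢[] (trans (sym (take++drop≡id p w))
                              (cong₂ _++_ (++-conicalʳ (drop p w) _ e) (++-conicalˡ _ (take p w) e)))

length-rotation : ∀ (w : Word) p → length (drop p w ++ take p w) ≡ length w
length-rotation w p = begin
  length (drop p w ++ take p w)           ≡⟨ length-++ (drop p w) ⟩
  length (drop p w) + length (take p w)   ≡⟨ +-comm (length (drop p w)) _ ⟩
  length (take p w) + length (drop p w)   ≡⟨ length-++ (take p w) ⟨
  length (take p w ++ drop p w)           ≡⟨ cong length (take++drop≡id p w) ⟩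
  length w                                ∎
  where open ≡-Reasoning

-- A repetition word shorter than w would produce a square, a second occurrence of P or of S, or a border.
repWord-long : ∀ {P S x₀ y₀ u} w x y → SquareFree w → Unbordered w →
               OnlyPrefix P w → OnlySuffix S w → P ≢ [] → S ≢ [] →
               w ≡ x ++ y → x ≡ P ++ x₀ → y ≡ y₀ ++ S → u ≢ [] →
               (∃[ x′ ] u ≡ x′ ++ x) ⊎ (∃[ x′ ] x ≡ x′ ++ u) →
               (∃[ y′ ] u ≡ y ++ y′) ⊎ (∃[ y′ ] y ≡ u ++ y′) →
               length w ≤ length u
repWord-long {P} {S} {x₀} {y₀} {u} w x y squareFree unbordered onlyP onlyS P≢[] S≢[] w≡ x≡ y≡ u≢[] =
  cases
  where
  cases : (∃[ x′ ] u ≡ x′ ++ x) ⊎ (∃[ x′ ] x ≡ x′ ++ u) →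
          (∃[ y′ ] u ≡ y ++ y′) ⊎ (∃[ y′ ] y ≡ u ++ y′) →
          length w ≤ length u
  cases (inj₂ (x′ , x≡x′u)) (inj₂ (y′ , y≡uy′)) = ⊥-elim (squareFree x′ u y′ u≢[] (begin
    w                          ≡⟨ w≡ ⟩
    x ++ y                     ≡⟨ cong₂ _++_ x≡x′u y≡uy′ ⟩
    (x′ ++ u) ++ (u ++ y′)     ≡⟨ solve (++-monoid (Fin 3)) ⟩
    x′ ++ (u ++ u) ++ y′       ∎))
    where open ≡-Reasoning
  cases (inj₁ (x′ , u≡x′x)) (inj₂ (y′ , y≡uy′)) =
    ⊥-elim (P≢[] (++-conicalˡ P x₀ (trans (sym x≡) (++-conicalˡ x x′ (onlyP (x ++ x′) (x₀ ++ y′) (begin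
      w                             ≡⟨ w≡ ⟩
      x ++ y                        ≡⟨ cong (x ++_) (trans y≡uy′ (cong (_++ y′) u≡x′x)) ⟩
      x ++ (x′ ++ x) ++ y′          ≡⟨ cong (λ v → x ++ (x′ ++ v) ++ y′) x≡ ⟩
      x ++ (x′ ++ P ++ x₀) ++ y′    ≡⟨ solve (++-monoid (Fin 3)) ⟩
      (x ++ x′) ++ P ++ x₀ ++ y′    ∎))))))
    where open ≡-Reasoning
  cases (inj₂ (x′ , x≡x′u)) (inj₁ (y′ , u≡yy′)) =
    ⊥-elim (S≢[] (++-conicalʳ y₀ S (trans (sym y≡) (++-conicalʳ y′ y (onlyS (x′ ++ y₀) (y′ ++ y) (begin
      w                             ≡⟨ w≡ ⟩
      x ++ y                        ≡⟨ cong (_++ y) (trans x≡x′u (cong (x′ ++_) u≡yy′)) ⟩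
      (x′ ++ y ++ y′) ++ y          ≡⟨ cong (λ v → (x′ ++ v ++ y′) ++ y) y≡ ⟩
      (x′ ++ (y₀ ++ S) ++ y′) ++ y  ≡⟨ solve (++-monoid (Fin 3)) ⟩
      (x′ ++ y₀) ++ S ++ y′ ++ y    ∎))))))
    where open ≡-Reasoning
  cases (inj₁ (x′ , u≡x′x)) (inj₁ (y′ , u≡yy′)) with length w ≤? length u
  ... | yes n≤u = n≤u
  ... | no  n≰u = ⊥-elim (short-conjugate x′ y′ u≡x′x u≡yy′ (≰⇒> n≰u))
    where
    x′<y : ∀ x′ → u ≡ x′ ++ x → length u < length w → length x′ < length y
    x′<y x′ u≡x′x u<w = +-cancelʳ-< (length x) (length x′) (length y) (begin-strict
      length x′ + length x      ≡⟨ length-++ x′ ⟨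
      length (x′ ++ x)          ≡⟨ cong length u≡x′x ⟨
      length u                  <⟨ u<w ⟩
      length w                  ≡⟨ cong length w≡ ⟩
      length (x ++ y)           ≡⟨ length-++ x ⟩
      length x + length y       ≡⟨ +-comm (length x) (length y) ⟩
      length y + length x       ∎)
      where open ≤-Reasoning
    short-conjugate : ∀ x′ y′ → u ≡ x′ ++ x → u ≡ y ++ y′ → length u < length w → ⊥
    short-conjugate x′ y′ u≡x′x u≡yy′ u<w
      with r , y≡x′r , x≡ry′ ← ++-split x′ x y y′ (trans (sym u≡x′x) u≡yy′) (<⇒≤ (x′<y x′ u≡x′x u<w)) =
      unbordered r (y′ ++ x′) r≢[] (begin
        w                    ≡⟨ w≡ ⟩
        x ++ y               ≡⟨ cong₂ _++_ x≡ry′ y≡x′r ⟩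
        (r ++ y′) ++ x′ ++ r ≡⟨ solve (++-monoid (Fin 3)) ⟩
        r ++ (y′ ++ x′) ++ r ∎)
      where
      open ≡-Reasoning
      r≢[] : r ≢ []
      r≢[] r≡[] = <-irrefl (sym (cong length (trans y≡x′r (trans (cong (x′ ++_) r≡[]) (++-identityʳ x′)))))
                           (x′<y x′ u≡x′x u<w)

eta-interval : ∀ w a k → (∀ p → Critical w p ⇔ (a ≤ p × p < a + k)) → Eta w k
eta-interval w a k critical⇔ = applyUpTo (a +_) k , unique , membership , length-applyUpTo (a +_) k
  where
  unique : Unique (applyUpTo (a +_) k)
  unique = applyUpTo⁺₁ (a +_) k (λ i<j _ a+i≡a+j → <-irrefl (+-cancelˡ-≡ a _ _ a+i≡a+j) i<j)
  membership : ∀ p → (p ∈ applyUpTo (a +_) k → Critical w p) × (Critical w p → p ∈ applyUpTo (a +_) k)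
  membership p = member⇒critical , critical⇒member
    where
    member⇒critical : p ∈ applyUpTo (a +_) k → Critical w p
    member⇒critical p∈ with i , i<k , refl ← ∈-applyUpTo⁻ (a +_) p∈ =
      Equivalence.from (critical⇔ p) (m≤m+n a i , +-monoʳ-< a i<k)
    critical⇒member : Critical w p → p ∈ applyUpTo (a +_) k
    critical⇒member c with a≤p , p<a+k ← Equivalence.to (critical⇔ p) c =
      subst (_∈ applyUpTo (a +_) k) (m+[n∸m]≡n a≤p)
            (∈-applyUpTo⁺ (a +_) (+-cancelˡ-< a (p ∸ a) k (subst (_< a + k) (sym (m+[n∸m]≡n a≤p)) p<a+k)))

module CriticalPoints (w X Y : Word)
  (w≡prefix : w ≡ c0 ∷ c1 ∷ c0 ∷ c2 ∷ c0 ∷ c1 ∷ X)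
  (w≡suffix : w ≡ Y ++ c1 ∷ c2 ∷ c0 ∷ c2 ∷ c1 ∷ c2 ∷ [])
  (squareFree : SquareFree w)
  (only010 : OnlyPrefix (c0 ∷ c1 ∷ c0 ∷ []) w)
  (only212 : OnlySuffix (c2 ∷ c1 ∷ c2 ∷ []) w)
  where

  w≢[] : w ≢ []
  w≢[] w≡[] with () ← trans (sym w≡prefix) w≡[]

  length-w : length w ≡ length Y + 6
  length-w = trans (cong length w≡suffix) (length-++ Y)

  6≤w : 6 ≤ length w
  6≤w = ≤-trans (m≤n+m 6 (length Y)) (≤-reflexive (sym length-w))

  4+Y≤w : 4 + length Y ≤ length w
  4+Y≤w = begin
    4 + length Y       ≡⟨ +-comm 4 (length Y) ⟩
    length Y + 4       ≤⟨ +-monoʳ-≤ (length Y) (m≤m+n 4 2) ⟩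
    length Y + 6       ≡⟨ length-w ⟨
    length w           ∎
    where open ≤-Reasoning

  ends-with-2 : ∀ Z c → w ≡ Z ++ c ∷ [] → c ≡ c2
  ends-with-2 Z c w≡Zc = ∷ʳ-injectiveʳ Z (Y ++ c1 ∷ c2 ∷ c0 ∷ c2 ∷ c1 ∷ [])
                           (trans (sym w≡Zc) (trans w≡suffix (sym (++-assoc Y _ (c2 ∷ [])))))

  unbordered : Unbordered w
  unbordered []          M r≢[] _ = r≢[] refl
  unbordered (c ∷ [])    M _ w≡
    with refl ← ∷-injectiveˡ (trans (sym w≡prefix) w≡)
    with () ← ends-with-2 (c0 ∷ M) c0 w≡
  unbordered (c ∷ d ∷ []) M _ w≡
    with refl , w≡′ ← ∷-injective (trans (sym w≡prefix) w≡)
    with refl ← ∷-injectiveˡ w≡′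
    with () ← ends-with-2 (c0 ∷ c1 ∷ M ++ c0 ∷ []) c1
                           (trans w≡ (cong (λ v → c0 ∷ c1 ∷ v) (sym (++-assoc M (c0 ∷ []) (c1 ∷ [])))))
  unbordered (c ∷ d ∷ f ∷ r) M _ w≡
    with refl , w≡′ ← ∷-injective (trans (sym w≡prefix) w≡)
    with refl , w≡″ ← ∷-injective w≡′
    with refl ← ∷-injectiveˡ w≡″
    with () ← only010 (c0 ∷ c1 ∷ c0 ∷ r ++ M) r
                       (trans w≡ (cong (λ v → c0 ∷ c1 ∷ c0 ∷ v) (sym (++-assoc r M _))))

  minPer : MinPer w (length w)
  minPer = minPer-length w w≢[] squareFree unbordered

  take-starts-with-010 : ∀ p → 3 ≤ p → ∃[ x₀ ] take p w ≡ (c0 ∷ c1 ∷ c0 ∷ []) ++ x₀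
  take-starts-with-010 (suc (suc (suc p))) _ = take p (c2 ∷ c0 ∷ c1 ∷ X) , cong (take (3 + p)) w≡prefix
  take-starts-with-010 2 (s≤s (s≤s ()))
  take-starts-with-010 1 (s≤s ())
  take-starts-with-010 0 ()

  drop-ends-with-212 : ∀ p → p < 4 + length Y → ∃[ y₀ ] drop p w ≡ y₀ ++ (c2 ∷ c1 ∷ c2 ∷ [])
  drop-ends-with-212 p p<4+Y = drop p Y₃ , trans (cong (drop p) w≡Y₃212) (drop-++-≤ Y₃ _ p p≤Y₃)
    where
    Y₃ = Y ++ c1 ∷ c2 ∷ c0 ∷ []
    w≡Y₃212 : w ≡ Y₃ ++ c2 ∷ c1 ∷ c2 ∷ []
    w≡Y₃212 = trans w≡suffix (sym (++-assoc Y _ _))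
    p≤Y₃ : p ≤ length Y₃
    p≤Y₃ = ≤-trans (≤-pred p<4+Y) (≤-reflexive (trans (+-comm 3 (length Y)) (sym (length-++ Y))))

  localPer-inner : ∀ p → 3 ≤ p → p < 4 + length Y → LocalPer w p (length w)
  localPer-inner p 3≤p p<4+Y =
    (drop p w ++ take p w , rotation-repWord w p w≢[] , length-rotation w p) , long
    where
    long : ∀ u → RepWord w p u → length w ≤ length u
    long u (u≢[] , left , right) =
      repWord-long w (take p w) (drop p w) squareFree unbordered only010 only212 (λ ()) (λ ())
                   (sym (take++drop≡id p w)) (proj₂ (take-starts-with-010 p 3≤p))
                   (proj₂ (drop-ends-with-212 p p<4+Y)) u≢[] left right

  shortRepWord : ∀ p → 1 ≤ p → p < length w → ¬ (3 ≤ p × p < 4 + length Y) →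
                 ∃[ u ] (RepWord w p u × length u < length w)
  shortRepWord 1 _ _ _ =
    c1 ∷ c0 ∷ [] ,
    subst (λ v → RepWord v 1 _) (sym w≡prefix) ((λ ()) , inj₁ (c1 ∷ [] , refl) , inj₂ (_ , refl)) ,
    ≤-trans (s≤s (s≤s (s≤s z≤n))) 6≤w
  shortRepWord 2 _ _ _ =
    c0 ∷ c2 ∷ c0 ∷ c1 ∷ [] ,
    subst (λ v → RepWord v 2 _) (sym w≡prefix) ((λ ()) , inj₁ (c0 ∷ c2 ∷ [] , refl) , inj₂ (X , refl)) ,
    ≤-trans (s≤s (s≤s (s≤s (s≤s (s≤s z≤n))))) 6≤w
  shortRepWord p@(suc (suc (suc _))) _ p<w not-inner
    with k , 4+Y+k≡p ← m≤n⇒∃[o]m+o≡n (≮⇒≥ (λ p<4+Y → not-inner (s≤s (s≤s (s≤s z≤n)) , p<4+Y))) =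
    subst (λ p → ∃[ u ] (RepWord w p u × length u < length w)) (sym p≡)
          (near-end k (subst (_< length w) p≡ p<w))
    where
    p≡ : p ≡ length Y + (4 + k)
    p≡ = trans (sym 4+Y+k≡p) (trans (cong (_+ k) (+-comm 4 (length Y))) (+-assoc (length Y) 4 k))
    near-end : ∀ k → length Y + (4 + k) < length w →
               ∃[ u ] (RepWord w (length Y + (4 + k)) u × length u < length w)
    near-end 0 _ =
      c1 ∷ c2 ∷ c0 ∷ c2 ∷ [] ,
      subst (λ v → RepWord v (length Y + 4) _) (sym w≡suffix)
            ((λ ()) , inj₂ (Y , take-length-++ Y _ 4) ,
             inj₁ (c0 ∷ c2 ∷ [] , cong (_++ c0 ∷ c2 ∷ []) (sym (drop-length-++ Y _ 4)))) ,
      ≤-trans (s≤s (s≤s (s≤s (s≤s (s≤s z≤n))))) 6≤w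
    near-end 1 _ =
      c2 ∷ c1 ∷ [] ,
      subst (λ v → RepWord v (length Y + 5) _) (sym w≡suffix)
            ((λ ()) , inj₂ (Y ++ c1 ∷ c2 ∷ c0 ∷ [] , trans (take-length-++ Y _ 5) (sym (++-assoc Y _ _))) ,
             inj₁ (c1 ∷ [] , cong (_++ c1 ∷ []) (sym (drop-length-++ Y _ 5)))) ,
      ≤-trans (s≤s (s≤s (s≤s z≤n))) 6≤w
    near-end (suc (suc k)) Y+6+k<w =
      ⊥-elim (<⇒≱ Y+6+k<w (≤-trans (≤-reflexive length-w) (+-monoʳ-≤ (length Y) (m≤m+n 6 k))))
  shortRepWord 0 () _ _

  critical⇔ : ∀ p → Critical w p ⇔ (3 ≤ p × p < 4 + length Y)
  critical⇔ p = mk⇔ critical⇒inner inner⇒critical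
    where
    inner⇒critical : 3 ≤ p × p < 4 + length Y → Critical w p
    inner⇒critical (3≤p , p<4+Y) =
      (≤-trans (s≤s z≤n) 3≤p , ≤-trans p<4+Y 4+Y≤w) , length w , localPer-inner p 3≤p p<4+Y , minPer
    critical⇒inner : Critical w p → 3 ≤ p × p < 4 + length Y
    critical⇒inner ((1≤p , p<w) , q , (_ , q≤rep) , (q-period , _))
      with (3 ≤? p) ×-dec (p <? 4 + length Y)
    ... | yes inner = inner
    ... | no not-inner with u , rep , u<w ← shortRepWord p 1≤p p<w not-inner =
      ⊥-elim (<⇒≱ u<w (≤-trans (proj₂ minPer q q-period) (q≤rep u rep)))

  eta : Eta w (suc (length Y))
  eta = eta-interval w 3 (suc (length Y)) critical⇔

  eta+5≡length : suc (length Y) + 5 ≡ length w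
  eta+5≡length = trans (sym (+-suc (length Y) 5)) (sym length-w)

vtmWord : ℕ → Word
vtmWord n = framed (window vtm 1 (5 + (n + n)))

vtmWord-suffix : ∀ n → Block1001At n →
                 vtmWord n ≡ (c0 ∷ window vtm 1 (n + n)) ++ c1 ∷ c2 ∷ c0 ∷ c2 ∷ c1 ∷ c2 ∷ []
vtmWord-suffix n block = begin
  c0 ∷ window vtm 1 (5 + (n + n)) ++ c2 ∷ []
    ≡⟨ cong (λ l → c0 ∷ window vtm 1 l ++ c2 ∷ []) (+-comm 5 (n + n)) ⟩
  c0 ∷ window vtm 1 ((n + n) + 5) ++ c2 ∷ []
    ≡⟨ cong (λ V → c0 ∷ V ++ c2 ∷ []) (window-++ vtm 1 (n + n) 5) ⟩
  c0 ∷ (window vtm 1 (n + n) ++ window vtm (suc (n + n)) 5) ++ c2 ∷ []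
    ≡⟨ cong (λ T → c0 ∷ (window vtm 1 (n + n) ++ T) ++ c2 ∷ []) (vtm-tail n block) ⟩
  c0 ∷ (window vtm 1 (n + n) ++ c1 ∷ c2 ∷ c0 ∷ c2 ∷ c1 ∷ []) ++ c2 ∷ []
    ≡⟨ cong (c0 ∷_) (++-assoc (window vtm 1 (n + n)) _ _) ⟩
  (c0 ∷ window vtm 1 (n + n)) ++ c1 ∷ c2 ∷ c0 ∷ c2 ∷ c1 ∷ c2 ∷ []
    ∎
  where open ≡-Reasoning

vtmWord-squareFree : ∀ n → Block1001At n → SquareFree (vtmWord n)
vtmWord-squareFree n block =
  framed-squareFree _ {Y = Y ++ c1 ∷ c2 ∷ []} (window-vtm-squareFree 1 L) (window-vtm-no010 1 L)
                    (window-vtm-no212 1 L) refl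
                    (trans (vtmWord-suffix n block) (sym (++-assoc Y (c1 ∷ c2 ∷ []) _)))
  where
  L = 5 + (n + n)
  Y = c0 ∷ window vtm 1 (n + n)

vtmWord-only010 : ∀ n → OnlyPrefix (c0 ∷ c1 ∷ c0 ∷ []) (vtmWord n)
vtmWord-only010 n = framed-only010 _ (window-vtm-no010 1 (5 + (n + n)))

vtmWord-only212 : ∀ n → OnlySuffix (c2 ∷ c1 ∷ c2 ∷ []) (vtmWord n)
vtmWord-only212 n = framed-only212 _ (window-vtm-no212 1 (5 + (n + n)))

vtmWord-long : ∀ n → n ≤ length (vtmWord n)
vtmWord-long n = begin
  n                           ≤⟨ m≤n+m n (5 + n) ⟩
  5 + n + n                   ≡⟨ +-assoc 5 n n ⟩
  5 + (n + n)                 ≡⟨ length-window vtm 1 _ ⟨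
  length V                    ≤⟨ m≤m+n (length V) 1 ⟩
  length V + 1                ≡⟨ length-++ V ⟨
  length (V ++ c2 ∷ [])       ≤⟨ n≤1+n _ ⟩
  length (vtmWord n)          ∎
  where
  open ≤-Reasoning
  V = window vtm 1 (5 + (n + n))

mainTheorem8 : ∀ (N : ℕ) → ∃[ w ] (SquareFree w × N ≤ length w × ∃[ k ] (Eta w k × k + 5 ≡ length w))
mainTheorem8 N with n , N≤n , block ← block1001-unbounded N =
  vtmWord n , vtmWord-squareFree n block , ≤-trans N≤n (vtmWord-long n) , _ , eta , eta+5≡length
  where
  open CriticalPoints (vtmWord n) (window vtm 6 (n + n) ++ c2 ∷ []) (c0 ∷ window vtm 1 (n + n))
                      refl (vtmWord-suffix n block) (vtmWord-squareFree n block)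
                      (vtmWord-only010 n) (vtmWord-only212 n)
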